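{- Let $n\ge4$ and let $w\in W(D_n)$ be bad. Then $w(2)<0<w(3)$, and $(|w(1)|,|w(2)|,|w(3)|)$ is in the same relative order as one of $(1,2,3)$, $(1,3,2)$, $(2,1,3)$ (with $w(1)$ of either sign). In particular $|w(1)|<w(3)$.
   Context: $W(D_n)$ is the Coxeter group with generators $s_1,\dots,s_n$, where $s_1s_3$, $s_2s_3$, $s_is_{i+1}$ ($3\le i\le n-1$) have order 3 and all other pairs of distinct generators commute, realized as signed permutations of $\{\pm1,\dots,\pm n\}$ with an even number of sign changes via $s_1\mapsto(1,-2)(-1,2)$, $s_i\mapsto(i-1,i)(-(i-1),-i)$ ($i\ge2$), products being compositions of functions; $w(i)$ denotes the value of the signed permutation $w$ at $i$. An element is bad if it is not a product of mutually commuting generators and no reduced expression of it begins or ends with two noncommuting generators. -}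

module Defs where

open import Data.Nat using (ℕ; zero; suc; _≤_; _<_)
open import Data.Integer as ℤ using (ℤ; +_; -_)
open import Data.Fin using (Fin; toℕ)
open import Data.List using (List; []; _∷_; _++_; length)
open import Data.List.Relation.Unary.AllPairs using (AllPairs)
open import Data.Product using (Σ; _×_; ∃; ∃-syntax)
open import Data.Bool using (if_then_else_)
open import Relation.Nullary using (¬_)
open import Relation.Nullary.Decidable using (⌊_⌋)
open import Relation.Binary.PropositionalEquality using (_≡_)

-- Signed permutations of {±1,…,±n} are modelled as functions ℤ → ℤ
-- (only the values on ±1,…,±n matter).

swap : ℤ → ℤ → ℤ → ℤ
swap a b x = if ⌊ x ℤ.≟ a ⌋ then b else (if ⌊ x ℤ.≟ b ⌋ then a else x)

act : ℕ → ℤ → ℤ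
act zero x = x   -- unused (no generator s_0)
act (suc zero) x = swap (+ 1) (- (+ 2)) (swap (- (+ 1)) (+ 2) x)
act (suc (suc k)) x =
  swap (+ suc k) (+ suc (suc k)) (swap (- (+ suc k)) (- (+ suc (suc k))) x)

-- Generators of W(D_n): the letter j : Fin n stands for s_(j+1).
num : {n : ℕ} → Fin n → ℕ
num j = suc (toℕ j)

eval : {n : ℕ} → List (Fin n) → ℤ → ℤ
eval [] x = x
eval (s ∷ u) x = act (num s) (eval u x)

val : {n : ℕ} → List (Fin n) → ℕ → ℤ
val u j = eval u (+ j)

-- Two words represent the same element of W(D_n)
-- (a signed permutation is determined by its values at 1,…,n).
SameElt : (n : ℕ) → List (Fin n) → List (Fin n) → Set
SameElt n u v = (j : Fin n) → val u (num j) ≡ val v (num j)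

-- Noncommuting pairs of generators (those with product of order 3):
-- s_1 s_3, s_2 s_3, s_i s_{i+1} (3 ≤ i ≤ n-1), in both orders.
data NonComm : ℕ → ℕ → Set where
  nc13 : NonComm 1 3
  nc31 : NonComm 3 1
  nc23 : NonComm 2 3
  nc32 : NonComm 3 2
  ncUp : (k : ℕ) → 3 ≤ k → NonComm k (suc k)
  ncDown : (k : ℕ) → 3 ≤ k → NonComm (suc k) k

NonCommGen : {n : ℕ} → Fin n → Fin n → Set
NonCommGen s t = NonComm (num s) (num t)

Reduced : (n : ℕ) → List (Fin n) → Set
Reduced n u = (v : List (Fin n)) → SameElt n v u → length u ≤ length v

BeginsNC : {n : ℕ} → List (Fin n) → Set
BeginsNC {n} u = ∃[ s ] ∃[ t ] ∃[ r ] (u ≡ s ∷ t ∷ r × NonCommGen s t)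

EndsNC : {n : ℕ} → List (Fin n) → Set
EndsNC {n} u = ∃[ r ] ∃[ s ] ∃[ t ] (u ≡ r ++ (s ∷ t ∷ []) × NonCommGen s t)

MutuallyCommuting : {n : ℕ} → List (Fin n) → Set
MutuallyCommuting u = AllPairs (λ s t → ¬ NonCommGen s t) u

Bad : (n : ℕ) → List (Fin n) → Set
Bad n u =
  (¬ (∃[ v ] (SameElt n v u × MutuallyCommuting v))) ×
  ((v : List (Fin n)) → SameElt n v u → Reduced n v →
     ¬ BeginsNC v × ¬ EndsNC v)

-- Write g i = w(i). The length of w is the type D inversion count
-- #{i < j : g i > g j} + #{i < j : g i + g j < 0}, and right multiplication by s_k lowers it
-- by one exactly when s_k is a right descent of w. So if s_t is a descent of w and s_s one of
-- w s_t, a shortest expression of w s_t s_s followed by s_s s_t is a reduced expression of w;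
-- for bad w this is excluded when s and t do not commute, and the same holds for w⁻¹, whose
-- reduced expressions are the reversed ones. These exclusions are inequalities between
-- neighbouring entries of g. If g has a negative entry, they put the minimum of g at position
-- 1 or 2 and, with the evenness of the number of negative entries, give g 2 < 0 and |g 1| < g 3.
-- If all entries are positive, w is a permutation of {1,…,n}; the inequalities for w and w⁻¹
-- put n either at position n, or at position n − 1 with w(n) = n − 1, and induction writes w as
-- a product of commuting generators, which a bad element is not.

module Submission where

open import Defs
open import Data.Nat using (ℕ; _≤_; _<_)
open import Data.Integer using (ℤ; +_; ∣_∣) renaming (_<_ to _<ℤ_)
open import Data.Fin using (Fin)
open import Data.List using (List)
open import Data.Product using (_×_)
open import Data.Sum using (_⊎_)

open import Data.Nat as ℕ using (zero; suc; z≤n; s≤s; pred; _≤′_; ≤′-refl; ≤′-step)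
import Data.Nat.Properties as ℕ
import Data.Nat.Tactic.RingSolver as ℕ-Solver
open import Algebra.Properties.CommutativeSemigroup ℕ.+-commutativeSemigroup using (xy∙z≈xz∙y)
open import Data.Integer as ℤ using (-[1+_]; -_; _+_; 0ℤ) renaming (_≤_ to _≤ℤ_)
import Data.Integer.Properties as ℤ
open import Algebra.Properties.AbelianGroup ℤ.+-0-abelianGroup using (inverseˡ-unique; \\-leftDividesʳ)
open import Data.Bool using (Bool; true; false; not; _xor_; if_then_else_)
open import Data.Bool.Properties using (xor-assoc; xor-comm; xor-identityʳ; xor-annihilates-not)
open import Data.Fin as Fin using (toℕ; fromℕ<)
import Data.Fin.Properties as Fin
open import Data.List using ([]; _∷_; _++_; _∷ʳ_; reverse; length)
open import Data.List.Properties using (unfold-reverse; reverse-involutive; reverse-++; ++-assoc; length-++; length-reverse)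
open import Data.List.Reverse using (Reverse; []; _∶_∶ʳ_; reverseView)
open import Data.List.Relation.Unary.All as All using (All; []; _∷_)
open import Data.List.Relation.Unary.AllPairs using ([]; _∷_)
open import Data.Product using (_,_; proj₁; proj₂; ∃; ∃-syntax)
open import Data.Sum using (inj₁; inj₂; [_,_]′)
import Data.Sum as Sum
open import Data.Empty using (⊥; ⊥-elim)
open import Function using (_∘_; id)
open import Function.Bundles using (mk⇔)
open import Relation.Nullary using (¬_; Dec; yes; no)
open import Relation.Nullary.Decidable using (does; does-⇔; dec-true; dec-false)
open import Relation.Binary.Definitions using (tri<; tri≈; tri>)
open import Relation.Binary.PropositionalEquality

≤-suc-cases : ∀ {j m} → j ≤ suc m → j ≤ m ⊎ j ≡ suc m
≤-suc-cases j≤1+m = Sum.map₁ ℕ.≤-pred (ℕ.m≤n⇒m<n∨m≡n j≤1+m)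

≤-suc-suc-cases : ∀ {p m} → p ≤ suc (suc m) → p ≤ m ⊎ p ≡ suc m ⊎ p ≡ suc (suc m)
≤-suc-suc-cases p≤2+m with ≤-suc-cases p≤2+m
... | inj₂ p≡2+m = inj₂ (inj₂ p≡2+m)
... | inj₁ p≤1+m = [ inj₁ , inj₂ ∘ inj₁ ]′ (≤-suc-cases p≤1+m)

<-neg⇒+<0 : ∀ x y → y <ℤ - x → x + y <ℤ 0ℤ
<-neg⇒+<0 x y y<-x = subst (x + y <ℤ_) (ℤ.+-inverseʳ x) (ℤ.+-monoʳ-< x y<-x)

+<0⇒<-neg : ∀ x y → x + y <ℤ 0ℤ → y <ℤ - x
+<0⇒<-neg x y x+y<0 = subst₂ _<ℤ_ (\\-leftDividesʳ x y) (ℤ.+-identityʳ (- x)) (ℤ.+-monoʳ-< (- x) x+y<0)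

0<x+y⇒-x<y : ∀ x y → 0ℤ <ℤ x + y → - x <ℤ y
0<x+y⇒-x<y x y 0<x+y = subst₂ _<ℤ_ (ℤ.+-identityʳ (- x)) (\\-leftDividesʳ x y) (ℤ.+-monoʳ-< (- x) 0<x+y)

-x+-y≡-[y+x] : ∀ x y → - x + - y ≡ - (y + x)
-x+-y≡-[y+x] x y = trans (sym (ℤ.neg-distrib-+ x y)) (cong -_ (ℤ.+-comm x y))

-x+-y<0⇒0<y+x : ∀ x y → - x + - y <ℤ 0ℤ → 0ℤ <ℤ y + x
-x+-y<0⇒0<y+x x y p = ℤ.neg-cancel-< (subst (_<ℤ 0ℤ) (-x+-y≡-[y+x] x y) p)

0<y+x⇒-x+-y<0 : ∀ x y → 0ℤ <ℤ y + x → - x + - y <ℤ 0ℤ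
0<y+x⇒-x+-y<0 x y p = subst (_<ℤ 0ℤ) (sym (-x+-y≡-[y+x] x y)) (ℤ.neg-mono-< p)

∣∣<-intro : ∀ {x y} → x <ℤ y → - x <ℤ y → + ∣ x ∣ <ℤ y
∣∣<-intro {x} x<y -x<y with ℤ.+∣i∣≡i⊎+∣i∣≡-i x
... | inj₁ ∣x∣≡x = subst (_<ℤ _) (sym ∣x∣≡x) x<y
... | inj₂ ∣x∣≡-x = subst (_<ℤ _) (sym ∣x∣≡-x) -x<y

i≤+∣i∣ : ∀ i → i ≤ℤ + ∣ i ∣
i≤+∣i∣ (+ k) = ℤ.≤-refl
i≤+∣i∣ -[1+ k ] = ℤ.-≤+

swap-left : ∀ a b → swap a b a ≡ b
swap-left a b with a ℤ.≟ a
... | yes _ = refl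
... | no a≢a = ⊥-elim (a≢a refl)

swap-right : ∀ {a b} → b ≢ a → swap a b b ≡ a
swap-right {a} {b} b≢a with b ℤ.≟ a
... | yes b≡a = ⊥-elim (b≢a b≡a)
... | no _ with b ℤ.≟ b
...   | yes _ = refl
...   | no b≢b = ⊥-elim (b≢b refl)

swap-other : ∀ {a b x} → x ≢ a → x ≢ b → swap a b x ≡ x
swap-other {a} {b} {x} x≢a x≢b with x ℤ.≟ a
... | yes x≡a = ⊥-elim (x≢a x≡a)
... | no _ with x ℤ.≟ b
...   | yes x≡b = ⊥-elim (x≢b x≡b)
...   | no _ = refl

swapSuc : ℕ → ℕ → ℕ
swapSuc zero zero = 1
swapSuc zero (suc zero) = 0
swapSuc zero (suc (suc j)) = suc (suc j)
swapSuc (suc m) zero = zero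
swapSuc (suc m) (suc j) = suc (swapSuc m j)

swapSuc-left : ∀ m → swapSuc m m ≡ suc m
swapSuc-left zero = refl
swapSuc-left (suc m) = cong suc (swapSuc-left m)

swapSuc-right : ∀ m → swapSuc m (suc m) ≡ m
swapSuc-right zero = refl
swapSuc-right (suc m) = cong suc (swapSuc-right m)

swapSuc-other : ∀ {m j} → j ≢ m → j ≢ suc m → swapSuc m j ≡ j
swapSuc-other {zero} {zero} j≢m _ = ⊥-elim (j≢m refl)
swapSuc-other {zero} {suc zero} _ j≢1+m = ⊥-elim (j≢1+m refl)
swapSuc-other {zero} {suc (suc j)} _ _ = refl
swapSuc-other {suc m} {zero} _ _ = refl
swapSuc-other {suc m} {suc j} j≢m j≢1+m =
  cong suc (swapSuc-other (j≢m ∘ cong suc) (j≢1+m ∘ cong suc))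

swapSuc-involutive : ∀ m j → swapSuc m (swapSuc m j) ≡ j
swapSuc-involutive zero zero = refl
swapSuc-involutive zero (suc zero) = refl
swapSuc-involutive zero (suc (suc j)) = refl
swapSuc-involutive (suc m) zero = refl
swapSuc-involutive (suc m) (suc j) = cong suc (swapSuc-involutive m j)

swapSuc-< : ∀ {m j} → j < m → swapSuc m j ≡ j
swapSuc-< j<m = swapSuc-other (ℕ.<⇒≢ j<m) (ℕ.<⇒≢ (ℕ.m<n⇒m<1+n j<m))

swapSuc-> : ∀ {m j} → suc m < j → swapSuc m j ≡ j
swapSuc-> 1+m<j = swapSuc-other (ℕ.>⇒≢ (ℕ.<-trans (ℕ.n<1+n _) 1+m<j)) (ℕ.>⇒≢ 1+m<j)

swap-embed : (f : ℕ → ℤ) → (∀ {i j} → f i ≡ f j → i ≡ j) →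
             ∀ m j → swap (f m) (f (suc m)) (f j) ≡ f (swapSuc m j)
swap-embed f f-inj m j with j ℕ.≟ m | j ℕ.≟ suc m
... | yes refl | _ = trans (swap-left (f j) (f (suc j))) (cong f (sym (swapSuc-left j)))
... | no j≢m | yes refl =
  trans (swap-right (j≢m ∘ f-inj)) (cong f (sym (swapSuc-right m)))
... | no j≢m | no j≢1+m =
  trans (swap-other (j≢m ∘ f-inj) (j≢1+m ∘ f-inj)) (cong f (sym (swapSuc-other j≢m j≢1+m)))

-- act decides equalities with _≟_, which does not compute on open terms; act′ is the same map
-- given by cases.
actℕ : ℕ → ℕ → ℤ
actℕ zero j = + j
actℕ (suc zero) zero = 0ℤ
actℕ (suc zero) (suc zero) = - + 2
actℕ (suc zero) (suc (suc zero)) = - + 1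
actℕ (suc zero) (suc (suc (suc j))) = + suc (suc (suc j))
actℕ (suc (suc k)) j = + swapSuc (suc k) j

act′ : ℕ → ℤ → ℤ
act′ k (+ j) = actℕ k j
act′ k -[1+ j ] = - actℕ k (suc j)

act-+ : ∀ k j → act (suc (suc k)) (+ j) ≡ + swapSuc (suc k) j
act-+ k j =
  trans (cong (swap (+ suc k) (+ suc (suc k))) (swap-other { - + suc k} { - + suc (suc k)} {+ j} (λ ()) (λ ())))
        (swap-embed +_ ℤ.+-injective (suc k) j)

act--[1+] : ∀ k j → act (suc (suc k)) -[1+ j ] ≡ -[1+ swapSuc k j ]
act--[1+] k j =
  trans (cong (swap (+ suc k) (+ suc (suc k))) (swap-embed -[1+_] ℤ.-[1+-injective k j))
        (swap-other {+ suc k} {+ suc (suc k)} { -[1+ swapSuc k j ]} (λ ()) (λ ()))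

act≗act′ : ∀ k x → act k x ≡ act′ k x
act≗act′ zero (+ j) = refl
act≗act′ zero -[1+ j ] = refl
act≗act′ (suc zero) (+ zero) = refl
act≗act′ (suc zero) (+ suc zero) = refl
act≗act′ (suc zero) (+ suc (suc zero)) = refl
act≗act′ (suc zero) (+ suc (suc (suc j))) = refl
act≗act′ (suc zero) -[1+ zero ] = refl
act≗act′ (suc zero) -[1+ suc zero ] = refl
act≗act′ (suc zero) -[1+ suc (suc j) ] = refl
act≗act′ (suc (suc k)) (+ j) = act-+ k j
act≗act′ (suc (suc k)) -[1+ j ] = act--[1+] k j

actℕ-zero : ∀ k → actℕ k 0 ≡ 0ℤ
actℕ-zero zero = refl
actℕ-zero (suc zero) = refl
actℕ-zero (suc (suc k)) = refl

act′-odd : ∀ k x → act′ k (- x) ≡ - act′ k x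
act′-odd k (+ zero) rewrite actℕ-zero k = refl
act′-odd k (+ suc j) = refl
act′-odd k -[1+ j ] = sym (ℤ.neg-involutive _)

act′-involutive : ∀ k x → act′ k (act′ k x) ≡ x
act′-involutive zero (+ j) = refl
act′-involutive zero -[1+ j ] = refl
act′-involutive (suc zero) (+ zero) = refl
act′-involutive (suc zero) (+ suc zero) = refl
act′-involutive (suc zero) (+ suc (suc zero)) = refl
act′-involutive (suc zero) (+ suc (suc (suc j))) = refl
act′-involutive (suc zero) -[1+ zero ] = refl
act′-involutive (suc zero) -[1+ suc zero ] = refl
act′-involutive (suc zero) -[1+ suc (suc j) ] = refl
act′-involutive (suc (suc k)) (+ j) = cong +_ (swapSuc-involutive (suc k) j)
act′-involutive (suc (suc k)) -[1+ j ] = cong -[1+_] (swapSuc-involutive k j)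

act-involutive : ∀ k x → act k (act k x) ≡ x
act-involutive k x rewrite act≗act′ k x | act≗act′ k (act′ k x) = act′-involutive k x

act-odd : ∀ k x → act k (- x) ≡ - act k x
act-odd k x rewrite act≗act′ k x | act≗act′ k (- x) = act′-odd k x

∣act∣ : ∀ k x → ∣ act k x ∣ ≡ ∣ actℕ k ∣ x ∣ ∣
∣act∣ k x rewrite act≗act′ k x with x
... | + j = refl
... | -[1+ j ] = ℤ.∣-i∣≡∣i∣ (actℕ k (suc j))

InRange : ℕ → ℤ → Set
InRange n x = 1 ≤ ∣ x ∣ × ∣ x ∣ ≤ n

swapSuc-range : ∀ {n m j} → 1 ≤ m → suc m ≤ n → 1 ≤ j → j ≤ n → 1 ≤ swapSuc m j × swapSuc m j ≤ n
swapSuc-range {n} {m} {j} 1≤m m<n 1≤j j≤n with j ℕ.≟ m | j ℕ.≟ suc m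
... | yes refl | _ rewrite swapSuc-left j = s≤s z≤n , m<n
... | no _ | yes refl rewrite swapSuc-right m = 1≤m , ℕ.<⇒≤ m<n
... | no j≢m | no j≢1+m rewrite swapSuc-other j≢m j≢1+m = 1≤j , j≤n

actℕ-range : ∀ {n} k j → 2 ≤ n → k ≤ n → 1 ≤ j → j ≤ n → InRange n (actℕ k j)
actℕ-range zero j _ _ 1≤j j≤n = 1≤j , j≤n
actℕ-range (suc zero) (suc zero) 2≤n _ _ _ = s≤s z≤n , 2≤n
actℕ-range (suc zero) (suc (suc zero)) 2≤n _ _ _ = s≤s z≤n , ℕ.<⇒≤ 2≤n
actℕ-range (suc zero) (suc (suc (suc j))) _ _ 1≤j j≤n = 1≤j , j≤n
actℕ-range (suc (suc k)) j _ k≤n 1≤j j≤n = swapSuc-range (s≤s z≤n) k≤n 1≤j j≤n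

act-range : ∀ {n} k {x} → 2 ≤ n → k ≤ n → InRange n x → InRange n (act k x)
act-range k {x} 2≤n k≤n (1≤x , x≤n) rewrite ∣act∣ k x = actℕ-range k ∣ x ∣ 2≤n k≤n 1≤x x≤n

num≤ : ∀ {n} (s : Fin n) → num s ≤ n
num≤ s = Fin.toℕ<n s

generator : ∀ {n} k → suc k ≤ n → Fin n
generator k k<n = fromℕ< k<n

num-generator : ∀ {n} k (k<n : suc k ≤ n) → num (generator k k<n) ≡ suc k
num-generator k k<n = cong suc (Fin.toℕ-fromℕ< k<n)

NonComm-sym : ∀ {a b} → NonComm a b → NonComm b a
NonComm-sym nc13 = nc31
NonComm-sym nc31 = nc13
NonComm-sym nc23 = nc32
NonComm-sym nc32 = nc23
NonComm-sym (ncUp k 3≤k) = ncDown k 3≤k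
NonComm-sym (ncDown k 3≤k) = ncUp k 3≤k

module _ {n : ℕ} where

  eval-++ : (u v : List (Fin n)) (x : ℤ) → eval (u ++ v) x ≡ eval u (eval v x)
  eval-++ [] v x = refl
  eval-++ (s ∷ u) v x = cong (act (num s)) (eval-++ u v x)

  eval-reverse-inverseˡ : (u : List (Fin n)) (x : ℤ) → eval (reverse u) (eval u x) ≡ x
  eval-reverse-inverseˡ [] x = refl
  eval-reverse-inverseˡ (s ∷ u) x = begin
    eval (reverse (s ∷ u)) (act (num s) y)          ≡⟨ cong (λ v → eval v (act (num s) y)) (unfold-reverse s u) ⟩
    eval (reverse u ++ s ∷ []) (act (num s) y)      ≡⟨ eval-++ (reverse u) (s ∷ []) (act (num s) y) ⟩
    eval (reverse u) (act (num s) (act (num s) y))  ≡⟨ cong (eval (reverse u)) (act-involutive (num s) y) ⟩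
    eval (reverse u) y                              ≡⟨ eval-reverse-inverseˡ u x ⟩
    x                                               ∎
    where
    open ≡-Reasoning
    y = eval u x

  eval-reverse-inverseʳ : (u : List (Fin n)) (x : ℤ) → eval u (eval (reverse u) x) ≡ x
  eval-reverse-inverseʳ u x =
    subst (λ v → eval v (eval (reverse u) x) ≡ x) (reverse-involutive u)
          (eval-reverse-inverseˡ (reverse u) x)

  eval-odd : (u : List (Fin n)) (x : ℤ) → eval u (- x) ≡ - eval u x
  eval-odd [] x = refl
  eval-odd (s ∷ u) x = trans (cong (act (num s)) (eval-odd u x)) (act-odd (num s) (eval u x))

  eval-injective : (u : List (Fin n)) {x y : ℤ} → eval u x ≡ eval u y → x ≡ y
  eval-injective u {x} {y} e =
    trans (sym (eval-reverse-inverseˡ u x)) (trans (cong (eval (reverse u)) e) (eval-reverse-inverseˡ u y))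

  val-injective : (u : List (Fin n)) {i j : ℕ} → val u i ≡ val u j → i ≡ j
  val-injective u e = ℤ.+-injective (eval-injective u e)

  val≢-val : (u : List (Fin n)) (i j : ℕ) → val u (suc i) ≢ - val u j
  val≢-val u i j e with eval-injective u (trans e (sym (eval-odd u (+ j))))
  val≢-val u i zero e | ()
  val≢-val u i (suc j) e | ()

  val-zero : (u : List (Fin n)) → val u 0 ≡ 0ℤ
  val-zero [] = refl
  val-zero (s ∷ u) = trans (cong (act (num s)) (val-zero u)) (trans (act≗act′ (num s) 0ℤ) (actℕ-zero (num s)))

  val≢0 : (u : List (Fin n)) (j : ℕ) → val u (suc j) ≢ 0ℤ
  val≢0 u j e with val-injective u (trans e (sym (val-zero u)))
  ... | ()

eval-range : ∀ {n} → 2 ≤ n → (u : List (Fin n)) {x : ℤ} → InRange n x → InRange n (eval u x)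
eval-range 2≤n [] r = r
eval-range 2≤n (s ∷ u) r = act-range (num s) 2≤n (num≤ s) (eval-range 2≤n u r)

-- Windows: the values g i = w(i) of a signed permutation

Window : Set
Window = ℕ → ℤ

EqOn : Window → Window → ℕ → Set
EqOn g h m = ∀ i → 1 ≤ i → i ≤ m → g i ≡ h i

EqOn-pred : ∀ {g h m} → EqOn g h (suc m) → EqOn g h m
EqOn-pred e i 1≤i i≤m = e i 1≤i (ℕ.m≤n⇒m≤1+n i≤m)

EqOn-last : ∀ {g h m} → EqOn g h (suc m) → g (suc m) ≡ h (suc m)
EqOn-last e = e _ (s≤s z≤n) ℕ.≤-refl

swapWindow : Window → ℕ → Window
swapWindow g q j = g (swapSuc (suc q) j)

flipWindow : Window → Window
flipWindow g (suc zero) = - g 2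
flipWindow g (suc (suc zero)) = - g 1
flipWindow g j = g j

rightAct : ℕ → Window → Window
rightAct zero g = g
rightAct (suc zero) g = flipWindow g
rightAct (suc (suc q)) g = swapWindow g q

val-rightAct : ∀ {n} (u : List (Fin n)) k j → eval u (act k (+ j)) ≡ rightAct k (val u) j
val-rightAct u zero j = refl
val-rightAct u (suc zero) zero = refl
val-rightAct u (suc zero) (suc zero) = eval-odd u (+ 2)
val-rightAct u (suc zero) (suc (suc zero)) = eval-odd u (+ 1)
val-rightAct u (suc zero) (suc (suc (suc j))) = refl
val-rightAct u (suc (suc q)) j = cong (eval u) (act-+ q j)

val-snoc : ∀ {n} (u : List (Fin n)) s j → val (u ++ s ∷ []) j ≡ rightAct (num s) (val u) j
val-snoc u s j = trans (eval-++ u (s ∷ []) (+ j)) (val-rightAct u (num s) j)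

swapWindow-< : ∀ g q → EqOn (swapWindow g q) g q
swapWindow-< g q i _ i≤q = cong g (swapSuc-< (s≤s i≤q))

Descent : Window → ℕ → Set
Descent g zero = ⊥
Descent g (suc zero) = g 1 + g 2 <ℤ 0ℤ
Descent g (suc (suc q)) = g (suc (suc q)) <ℤ g (suc q)

Ascent : Window → ℕ → Set
Ascent g zero = ⊥
Ascent g (suc zero) = 0ℤ <ℤ g 1 + g 2
Ascent g (suc (suc q)) = g (suc q) <ℤ g (suc (suc q))

descent? : ∀ g k → Dec (Descent g k)
descent? g zero = no λ ()
descent? g (suc zero) = (g 1 + g 2) ℤ.<? 0ℤ
descent? g (suc (suc q)) = g (suc (suc q)) ℤ.<? g (suc q)

ascent? : ∀ g k → Dec (Ascent g k)
ascent? g zero = no λ ()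
ascent? g (suc zero) = 0ℤ ℤ.<? (g 1 + g 2)
ascent? g (suc (suc q)) = g (suc q) ℤ.<? g (suc (suc q))

Descent⇒¬Ascent : ∀ g k → Descent g k → ¬ Ascent g k
Descent⇒¬Ascent g (suc zero) d a = ℤ.<-asym d a
Descent⇒¬Ascent g (suc (suc q)) d a = ℤ.<-asym d a

Descent-cong : ∀ {g h} k → (∀ j → g j ≡ h j) → Descent h k → Descent g k
Descent-cong (suc zero) e d rewrite e 1 | e 2 = d
Descent-cong (suc (suc q)) e d rewrite e (suc q) | e (suc (suc q)) = d

¬Descent⇒Ascent : ∀ {n} (u : List (Fin n)) k → ¬ Descent (val u) (suc k) → Ascent (val u) (suc k)
¬Descent⇒Ascent u zero ¬d =
  ℤ.≤∧≢⇒< (ℤ.≮⇒≥ ¬d) (val≢-val u 0 2 ∘ inverseˡ-unique (val u 1) (val u 2) ∘ sym)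
¬Descent⇒Ascent u (suc q) ¬d =
  ℤ.≤∧≢⇒< (ℤ.≮⇒≥ ¬d) (ℕ.1+n≢n ∘ sym ∘ val-injective u)

increasing-squeeze : ∀ (f : Window) {a b} → (∀ i → a ≤ i → i < b → f i <ℤ f (suc i)) →
                     + a ≤ℤ f a → f b ≤ℤ + b → ∀ {j} → a ≤ j → j ≤ b → f j ≡ + j
increasing-squeeze f {a} {b} inc fa≥a fb≤b {j} a≤j j≤b =
  ℤ.≤-antisym (upper (proj₁ (ℕ.m≤n⇒∃[o]m+o≡n j≤b)) a≤j (proj₂ (ℕ.m≤n⇒∃[o]m+o≡n j≤b)))
              (lower (ℕ.≤⇒≤′ a≤j) j≤b)
  where
  lower : ∀ {i} → a ≤′ i → i ≤ b → + i ≤ℤ f i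
  lower ≤′-refl _ = fa≥a
  lower {suc i} (≤′-step a≤i) i<b =
    ℤ.≤-trans (ℤ.suc-mono (lower a≤i (ℕ.<⇒≤ i<b))) (ℤ.i<j⇒suc[i]≤j (inc i (ℕ.≤′⇒≤ a≤i) i<b))
  upper : ∀ d {i} → a ≤ i → i ℕ.+ d ≡ b → f i ≤ℤ + i
  upper zero {i} _ i+0≡b rewrite ℕ.+-identityʳ i | i+0≡b = fb≤b
  upper (suc d) {i} a≤i i+1+d≡b =
    ℤ.i<j⇒i≤pred[j] (ℤ.<-≤-trans (inc i a≤i i<b) (upper d (ℕ.m≤n⇒m≤1+n a≤i) (trans (sym (ℕ.+-suc i d)) i+1+d≡b)))
    where
    i<b : i < b
    i<b = subst (i <_) i+1+d≡b (ℕ.m<m+n i (s≤s z≤n))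

MinimumOn : Window → ℕ → ℕ → ℕ → Set
MinimumOn g lo hi p = lo ≤ p × p ≤ hi × (∀ j → lo ≤ j → j ≤ hi → g p ≤ℤ g j)

minimumOn : ∀ g {lo hi} → lo ≤ hi → ∃ (MinimumOn g lo hi)
minimumOn g lo≤hi = go (ℕ.≤⇒≤′ lo≤hi)
  where
  go : ∀ {lo hi} → lo ≤′ hi → ∃ (MinimumOn g lo hi)
  go {lo} ≤′-refl = lo , ℕ.≤-refl , ℕ.≤-refl , λ j lo≤j j≤lo → ℤ.≤-reflexive (cong g (ℕ.≤-antisym lo≤j j≤lo))
  go {lo} {suc hi} (≤′-step lo≤hi) with go lo≤hi
  ... | p , lo≤p , p≤hi , min with g p ℤ.≤? g (suc hi)
  ...   | yes gp≤ = p , lo≤p , ℕ.m≤n⇒m≤1+n p≤hi , λ j lo≤j j≤1+hi →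
      [ min j lo≤j , (λ { refl → gp≤ }) ]′ (≤-suc-cases j≤1+hi)
  ...   | no gp≰ = suc hi , ℕ.≤-trans (ℕ.≤′⇒≤ lo≤hi) (ℕ.n≤1+n hi) , ℕ.≤-refl , λ j lo≤j j≤1+hi →
      [ ℤ.≤-trans (ℤ.<⇒≤ (ℤ.≰⇒> gp≰)) ∘ min j lo≤j , (λ { refl → ℤ.≤-refl }) ]′ (≤-suc-cases j≤1+hi)

-- The length function

indicator : {P : Set} → Dec P → ℕ
indicator p = if does p then 1 else 0

indicator-cong : {P Q : Set} (p : Dec P) (q : Dec Q) → (P → Q) → (Q → P) → indicator p ≡ indicator q
indicator-cong p q f g rewrite does-⇔ (mk⇔ f g) p q = refl

indicator-yes : {P : Set} (p : Dec P) → P → indicator p ≡ 1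
indicator-yes p x rewrite dec-true p x = refl

indicator-no : {P : Set} (p : Dec P) → ¬ P → indicator p ≡ 0
indicator-no p ¬x rewrite dec-false p ¬x = refl

pairInversions : ℤ → ℤ → ℕ
pairInversions x y = indicator (y ℤ.<? x) ℕ.+ indicator ((x + y) ℤ.<? 0ℤ)

inversionsWith : Window → ℕ → ℤ → ℕ
inversionsWith g zero y = 0
inversionsWith g (suc m) y = inversionsWith g m y ℕ.+ pairInversions (g (suc m)) y

inversions : Window → ℕ → ℕ
inversions g zero = 0
inversions g (suc m) = inversions g m ℕ.+ inversionsWith g m (g (suc m))

inversionsWith-cong : ∀ {g h} m y → EqOn g h m → inversionsWith g m y ≡ inversionsWith h m y
inversionsWith-cong zero y e = refl
inversionsWith-cong {g} (suc m) y e =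
  cong₂ ℕ._+_ (inversionsWith-cong m y (EqOn-pred e)) (cong (λ z → pairInversions z y) (EqOn-last e))

inversions-cong : ∀ {g h} m → EqOn g h m → inversions g m ≡ inversions h m
inversions-cong zero e = refl
inversions-cong {g} {h} (suc m) e = cong₂ ℕ._+_ (inversions-cong m (EqOn-pred e)) (begin
  inversionsWith g m (g (suc m)) ≡⟨ inversionsWith-cong m (g (suc m)) (EqOn-pred e) ⟩
  inversionsWith h m (g (suc m)) ≡⟨ cong (inversionsWith h m) (EqOn-last e) ⟩
  inversionsWith h m (h (suc m)) ∎)
  where open ≡-Reasoning

inversions-id : ∀ m → inversions +_ m ≡ 0
inversions-id zero = refl
inversions-id (suc m) rewrite inversions-id m = inversionsWith-id m ℕ.≤-refl
  where
  inversionsWith-id : ∀ i → i ≤ m → inversionsWith +_ i (+ suc m) ≡ 0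
  inversionsWith-id zero _ = refl
  inversionsWith-id (suc i) i<m
    rewrite inversionsWith-id i (ℕ.<⇒≤ i<m)
          | indicator-no (+ suc m ℤ.<? + suc i) (λ p → ℕ.<⇒≱ (ℤ.drop‿+<+ p) (ℕ.m≤n⇒m≤1+n i<m))
          | indicator-no ((+ suc i + + suc m) ℤ.<? 0ℤ) λ { (ℤ.+<+ ()) } = refl

pairInversions-neg : ∀ x y → pairInversions (- x) y ≡ pairInversions x y
pairInversions-neg x y = begin
  indicator (y ℤ.<? - x) ℕ.+ indicator ((- x + y) ℤ.<? 0ℤ)
    ≡⟨ cong₂ ℕ._+_ (indicator-cong (y ℤ.<? - x) ((x + y) ℤ.<? 0ℤ) (<-neg⇒+<0 x y) (+<0⇒<-neg x y))
                   (indicator-cong ((- x + y) ℤ.<? 0ℤ) (y ℤ.<? x) -x+y<0⇒y<x y<x⇒-x+y<0) ⟩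
  indicator ((x + y) ℤ.<? 0ℤ) ℕ.+ indicator (y ℤ.<? x)
    ≡⟨ ℕ.+-comm (indicator ((x + y) ℤ.<? 0ℤ)) (indicator (y ℤ.<? x)) ⟩
  pairInversions x y ∎
  where
  open ≡-Reasoning
  -x+y<0⇒y<x : - x + y <ℤ 0ℤ → y <ℤ x
  -x+y<0⇒y<x p = subst (y <ℤ_) (ℤ.neg-involutive x) (+<0⇒<-neg (- x) y p)
  y<x⇒-x+y<0 : y <ℤ x → - x + y <ℤ 0ℤ
  y<x⇒-x+y<0 p = <-neg⇒+<0 (- x) y (subst (y <ℤ_) (sym (ℤ.neg-involutive x)) p)

inversionsWith-swap : ∀ g q y {m} → suc (suc q) ≤′ m →
                      inversionsWith (swapWindow g q) m y ≡ inversionsWith g m y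
inversionsWith-swap g q y ≤′-refl
  rewrite swapSuc-left (suc q) | swapSuc-right (suc q) | inversionsWith-cong q y (swapWindow-< g q) =
  xy∙z≈xz∙y (inversionsWith g q y) _ _
inversionsWith-swap g q y {suc m} (≤′-step q+2≤m) =
  cong₂ ℕ._+_ (inversionsWith-swap g q y q+2≤m)
              (cong (λ j → pairInversions (g j) y) (swapSuc-> (s≤s (ℕ.≤′⇒≤ q+2≤m))))

inversions-swap : ∀ g q {m} → suc (suc q) ≤′ m →
    inversions (swapWindow g q) m ℕ.+ pairInversions (g (suc q)) (g (suc (suc q)))
  ≡ inversions g m ℕ.+ pairInversions (g (suc (suc q))) (g (suc q))
inversions-swap g q ≤′-refl
  rewrite swapSuc-left (suc q) | swapSuc-right (suc q)
        | inversions-cong q (swapWindow-< g q)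
        | inversionsWith-cong q (g (suc q)) (swapWindow-< g q)
        | inversionsWith-cong q (g (suc (suc q))) (swapWindow-< g q) =
  exchange (inversions g q) _ _ _ _
  where
  exchange : ∀ a b c d e → ((a ℕ.+ b) ℕ.+ (c ℕ.+ d)) ℕ.+ e ≡ ((a ℕ.+ c) ℕ.+ (b ℕ.+ e)) ℕ.+ d
  exchange = ℕ-Solver.solve-∀
inversions-swap g q {suc m} (≤′-step q+2≤m) = begin
  (inversions h m ℕ.+ inversionsWith h m (h (suc m))) ℕ.+ c
    ≡⟨ cong (λ z → (inversions h m ℕ.+ z) ℕ.+ c)
            (trans (inversionsWith-swap g q _ q+2≤m) (cong (inversionsWith g m) h[1+m]≡g[1+m])) ⟩
  (inversions h m ℕ.+ r) ℕ.+ c  ≡⟨ xy∙z≈xz∙y (inversions h m) r c ⟩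
  (inversions h m ℕ.+ c) ℕ.+ r  ≡⟨ cong (ℕ._+ r) (inversions-swap g q q+2≤m) ⟩
  (inversions g m ℕ.+ c′) ℕ.+ r ≡⟨ xy∙z≈xz∙y (inversions g m) c′ r ⟩
  (inversions g m ℕ.+ r) ℕ.+ c′ ∎
  where
  open ≡-Reasoning
  h = swapWindow g q
  c = pairInversions (g (suc q)) (g (suc (suc q)))
  c′ = pairInversions (g (suc (suc q))) (g (suc q))
  r = inversionsWith g m (g (suc m))
  h[1+m]≡g[1+m] : h (suc m) ≡ g (suc m)
  h[1+m]≡g[1+m] = cong g (swapSuc-> (s≤s (ℕ.≤′⇒≤ q+2≤m)))

inversionsWith-flip : ∀ g y d → inversionsWith (flipWindow g) (suc (suc d)) y ≡ inversionsWith g (suc (suc d)) y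
inversionsWith-flip g y zero
  rewrite pairInversions-neg (g 2) y | pairInversions-neg (g 1) y = ℕ.+-comm (pairInversions (g 2) y) _
inversionsWith-flip g y (suc d) = cong (ℕ._+ pairInversions (g (3 ℕ.+ d)) y) (inversionsWith-flip g y d)

inversions-flip : ∀ g d →
    inversions (flipWindow g) (suc (suc d)) ℕ.+ indicator ((g 1 + g 2) ℤ.<? 0ℤ)
  ≡ inversions g (suc (suc d)) ℕ.+ indicator (0ℤ ℤ.<? (g 1 + g 2))
inversions-flip g zero
  rewrite indicator-cong (- g 1 ℤ.<? - g 2) (g 2 ℤ.<? g 1) ℤ.neg-cancel-< ℤ.neg-mono-<
        | indicator-cong ((- g 2 + - g 1) ℤ.<? 0ℤ) (0ℤ ℤ.<? (g 1 + g 2))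
                         (-x+-y<0⇒0<y+x (g 2) (g 1)) (0<y+x⇒-x+-y<0 (g 2) (g 1)) =
  xy∙z≈xz∙y (indicator (g 2 ℤ.<? g 1)) _ _
inversions-flip g (suc d) = begin
  (inversions g′ (2 ℕ.+ d) ℕ.+ inversionsWith g′ (2 ℕ.+ d) (g (3 ℕ.+ d))) ℕ.+ c
    ≡⟨ cong (λ z → (inversions g′ (2 ℕ.+ d) ℕ.+ z) ℕ.+ c) (inversionsWith-flip g _ d) ⟩
  (inversions g′ (2 ℕ.+ d) ℕ.+ r) ℕ.+ c   ≡⟨ xy∙z≈xz∙y (inversions g′ (2 ℕ.+ d)) r c ⟩
  (inversions g′ (2 ℕ.+ d) ℕ.+ c) ℕ.+ r   ≡⟨ cong (ℕ._+ r) (inversions-flip g d) ⟩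
  (inversions g (2 ℕ.+ d) ℕ.+ c′) ℕ.+ r   ≡⟨ xy∙z≈xz∙y (inversions g (2 ℕ.+ d)) c′ r ⟩
  (inversions g (2 ℕ.+ d) ℕ.+ r) ℕ.+ c′   ∎
  where
  open ≡-Reasoning
  g′ = flipWindow g
  c = indicator ((g 1 + g 2) ℤ.<? 0ℤ)
  c′ = indicator (0ℤ ℤ.<? (g 1 + g 2))
  r = inversionsWith g (2 ℕ.+ d) (g (3 ℕ.+ d))

inversions-rightAct : ∀ g k {m} → 2 ≤ m → k ≤ m →
    inversions (rightAct k g) m ℕ.+ indicator (descent? g k) ≡ inversions g m ℕ.+ indicator (ascent? g k)
inversions-rightAct g zero _ _ = refl
inversions-rightAct g (suc zero) (s≤s (s≤s {n = d} z≤n)) _ = inversions-flip g d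
inversions-rightAct g (suc (suc q)) {m} _ k≤m = ℕ.+-cancelʳ-≡ s _ _ (begin
  (inversions (swapWindow g q) m ℕ.+ d) ℕ.+ s ≡⟨ ℕ.+-assoc (inversions (swapWindow g q) m) d s ⟩
  inversions (swapWindow g q) m ℕ.+ (d ℕ.+ s) ≡⟨ inversions-swap g q (ℕ.≤⇒≤′ k≤m) ⟩
  inversions g m ℕ.+ (a ℕ.+ s′)               ≡⟨ cong (λ z → inversions g m ℕ.+ (a ℕ.+ z)) s′≡s ⟩
  inversions g m ℕ.+ (a ℕ.+ s)                ≡⟨ ℕ.+-assoc (inversions g m) a s ⟨
  (inversions g m ℕ.+ a) ℕ.+ s                ∎)
  where
  open ≡-Reasoning
  d = indicator (descent? g (suc (suc q)))
  a = indicator (ascent? g (suc (suc q)))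
  s = indicator ((g (suc q) + g (suc (suc q))) ℤ.<? 0ℤ)
  s′ = indicator ((g (suc (suc q)) + g (suc q)) ℤ.<? 0ℤ)
  s′≡s : s′ ≡ s
  s′≡s = cong (λ z → indicator (z ℤ.<? 0ℤ)) (ℤ.+-comm (g (suc (suc q))) (g (suc q)))

inversions-descent : ∀ g k {m} → 2 ≤ m → k ≤ m → Descent g k →
                     suc (inversions (rightAct k g) m) ≡ inversions g m
inversions-descent g k 2≤m k≤m d with inversions-rightAct g k 2≤m k≤m
... | count rewrite indicator-yes (descent? g k) d | indicator-no (ascent? g k) (Descent⇒¬Ascent g k d) =
  trans (ℕ.+-comm 1 _) (trans count (ℕ.+-identityʳ _))

inversions-ascent : ∀ g k {m} → 2 ≤ m → k ≤ m → ¬ Descent g k → Ascent g k →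
                    inversions (rightAct k g) m ≡ suc (inversions g m)
inversions-ascent g k 2≤m k≤m ¬d a with inversions-rightAct g k 2≤m k≤m
... | count rewrite indicator-no (descent? g k) ¬d | indicator-yes (ascent? g k) a =
  trans (sym (ℕ.+-identityʳ _)) (trans count (ℕ.+-comm _ 1))

-- An even number of sign changes

isNeg : ℤ → Bool
isNeg x = does (x ℤ.<? 0ℤ)

negParity : Window → ℕ → Bool
negParity g zero = false
negParity g (suc m) = negParity g m xor isNeg (g (suc m))

isNeg-neg : ∀ {x} → x ≢ 0ℤ → isNeg (- x) ≡ not (isNeg x)
isNeg-neg {x} x≢0 with x ℤ.<? 0ℤ
... | yes x<0 = dec-false ((- x) ℤ.<? 0ℤ) (ℤ.<-asym (ℤ.neg-mono-< x<0))
... | no x≮0 = dec-true ((- x) ℤ.<? 0ℤ) (ℤ.neg-mono-< (ℤ.≤∧≢⇒< (ℤ.≮⇒≥ x≮0) (x≢0 ∘ sym)))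

xor-swapʳ : ∀ a b c → (a xor b) xor c ≡ (a xor c) xor b
xor-swapʳ a b c = trans (xor-assoc a b c) (trans (cong (a xor_) (xor-comm b c)) (sym (xor-assoc a c b)))

negParity-cong : ∀ {g h} m → EqOn g h m → negParity g m ≡ negParity h m
negParity-cong zero e = refl
negParity-cong (suc m) e = cong₂ _xor_ (negParity-cong m (EqOn-pred e)) (cong isNeg (EqOn-last e))

negParity-swap : ∀ g q {m} → suc (suc q) ≤′ m → negParity (swapWindow g q) m ≡ negParity g m
negParity-swap g q ≤′-refl
  rewrite swapSuc-left (suc q) | swapSuc-right (suc q) | negParity-cong q (swapWindow-< g q) =
  xor-swapʳ (negParity g q) _ _
negParity-swap g q {suc m} (≤′-step q+2≤m) =
  cong₂ _xor_ (negParity-swap g q q+2≤m) (cong (isNeg ∘ g) (swapSuc-> (s≤s (ℕ.≤′⇒≤ q+2≤m))))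

negParity-flip : ∀ g d → g 1 ≢ 0ℤ → g 2 ≢ 0ℤ →
                 negParity (flipWindow g) (suc (suc d)) ≡ negParity g (suc (suc d))
negParity-flip g zero g1≢0 g2≢0 rewrite isNeg-neg g1≢0 | isNeg-neg g2≢0 =
  trans (xor-annihilates-not (isNeg (g 2)) (isNeg (g 1))) (xor-comm (isNeg (g 2)) (isNeg (g 1)))
negParity-flip g (suc d) g1≢0 g2≢0 = cong (_xor isNeg (g (3 ℕ.+ d))) (negParity-flip g d g1≢0 g2≢0)

negParity-rightAct : ∀ g k {m} → 2 ≤ m → k ≤ m → g 1 ≢ 0ℤ → g 2 ≢ 0ℤ →
                     negParity (rightAct k g) m ≡ negParity g m
negParity-rightAct g zero _ _ _ _ = refl
negParity-rightAct g (suc zero) (s≤s (s≤s {n = d} z≤n)) _ = negParity-flip g d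
negParity-rightAct g (suc (suc q)) _ k≤m _ _ = negParity-swap g q (ℕ.≤⇒≤′ k≤m)

negParity-id : ∀ m → negParity +_ m ≡ false
negParity-id zero = refl
negParity-id (suc m) = cong (_xor false) (negParity-id m)

negParity-positiveTail : ∀ g m → 1 ≤ m → (∀ j → 2 ≤ j → j ≤ m → 0ℤ ≤ℤ g j) →
                         negParity g m ≡ isNeg (g 1)
negParity-positiveTail g (suc zero) _ _ = refl
negParity-positiveTail g (suc (suc m)) _ pos
  rewrite negParity-positiveTail g (suc m) (s≤s z≤n) (λ j 2≤j j≤m → pos j 2≤j (ℕ.m≤n⇒m≤1+n j≤m))
        | dec-false (g (2 ℕ.+ m) ℤ.<? 0ℤ) (ℤ.≤⇒≯ (pos (2 ℕ.+ m) (s≤s (s≤s z≤n)) ℕ.≤-refl)) =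
  xor-identityʳ _

NoNoncommutingChain : ℕ → Window → Set
NoNoncommutingChain m g = ∀ {k k′} → k < m → k′ < m → NonComm (suc k′) (suc k) →
                          Descent g (suc k) → ¬ Descent (rightAct (suc k) g) (suc k′)

module _ (n : ℕ) (2≤n : 2 ≤ n) where

  val-snoc-EqOn : (u : List (Fin n)) (s : Fin n) → EqOn (val (u ∷ʳ s)) (rightAct (num s) (val u)) n
  val-snoc-EqOn u s i _ _ = val-snoc u s i

  inversions-snoc-descent : (u : List (Fin n)) (s : Fin n) → Descent (val u) (num s) →
                            suc (inversions (val (u ∷ʳ s)) n) ≡ inversions (val u) n
  inversions-snoc-descent u s d =
    trans (cong suc (inversions-cong n (val-snoc-EqOn u s))) (inversions-descent (val u) (num s) 2≤n (num≤ s) d)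

  inversions-snoc-≤ : (u : List (Fin n)) (s : Fin n) → inversions (val (u ∷ʳ s)) n ≤ suc (inversions (val u) n)
  inversions-snoc-≤ u s with descent? (val u) (num s)
  ... | yes d = ℕ.m≤n⇒m≤1+n (ℕ.<⇒≤ (ℕ.≤-reflexive (inversions-snoc-descent u s d)))
  ... | no ¬d = ℕ.≤-reflexive (trans (inversions-cong n (val-snoc-EqOn u s))
                                     (inversions-ascent (val u) (num s) 2≤n (num≤ s) ¬d (¬Descent⇒Ascent u (toℕ s) ¬d)))

  inversions≤length : (u : List (Fin n)) → inversions (val u) n ≤ length u
  inversions≤length u = go (reverseView u)
    where
    go : ∀ {u} → Reverse u → inversions (val u) n ≤ length u
    go [] = ℕ.≤-reflexive (inversions-id n)
    go (u ∶ r ∶ʳ s) = ℕ.≤-trans (inversions-snoc-≤ u s) (subst (suc (inversions (val u) n) ≤_) length-∷ʳ (s≤s (go r)))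
      where
      length-∷ʳ : suc (length u) ≡ length (u ∷ʳ s)
      length-∷ʳ = trans (ℕ.+-comm 1 (length u)) (sym (length-++ u))

  negParity-val : (u : List (Fin n)) → negParity (val u) n ≡ false
  negParity-val u = go (reverseView u)
    where
    go : ∀ {u} → Reverse u → negParity (val u) n ≡ false
    go [] = negParity-id n
    go (u ∶ r ∶ʳ s) = begin
      negParity (val (u ∷ʳ s)) n                ≡⟨ negParity-cong n (val-snoc-EqOn u s) ⟩
      negParity (rightAct (num s) (val u)) n    ≡⟨ negParity-rightAct (val u) (num s) 2≤n (num≤ s) (val≢0 u 0) (val≢0 u 1) ⟩
      negParity (val u) n                       ≡⟨ go r ⟩
      false                                     ∎
      where open ≡-Reasoning

  nonnegativeTail⇒val1≮0 : (u : List (Fin n)) → (∀ j → 2 ≤ j → j ≤ n → 0ℤ ≤ℤ val u j) →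
                           ¬ (val u 1 <ℤ 0ℤ)
  nonnegativeTail⇒val1≮0 u nonneg g1<0 with begin
    true               ≡⟨ dec-true (val u 1 ℤ.<? 0ℤ) g1<0 ⟨
    isNeg (val u 1)    ≡⟨ negParity-positiveTail (val u) n (ℕ.<⇒≤ 2≤n) nonneg ⟨
    negParity (val u) n ≡⟨ negParity-val u ⟩
    false              ∎
    where open ≡-Reasoning
  ... | ()

  SameElt⇒EqOn : (v u : List (Fin n)) → SameElt n v u → EqOn (val v) (val u) n
  SameElt⇒EqOn v u e (suc i) _ i<n =
    subst (λ j → val v j ≡ val u j) (cong suc (Fin.toℕ-fromℕ< i<n)) (e (fromℕ< i<n))

  EqOn⇒SameElt : (v u : List (Fin n)) → EqOn (val v) (val u) n → SameElt n v u
  EqOn⇒SameElt v u e j = e (num j) (s≤s z≤n) (num≤ j)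

  eval-cong : (v u : List (Fin n)) → EqOn (val v) (val u) n → ∀ {x} → InRange n x → eval v x ≡ eval u x
  eval-cong v u e {+ j} (1≤j , j≤n) = e j 1≤j j≤n
  eval-cong v u e { -[1+ j ]} (1≤j , j≤n) = begin
    eval v (- + suc j)  ≡⟨ eval-odd v (+ suc j) ⟩
    - val v (suc j)     ≡⟨ cong -_ (e (suc j) 1≤j j≤n) ⟩
    - val u (suc j)     ≡⟨ eval-odd u (+ suc j) ⟨
    eval u (- + suc j)  ∎
    where open ≡-Reasoning

  SameElt-reverse : (v u : List (Fin n)) → SameElt n v u → SameElt n (reverse v) (reverse u)
  SameElt-reverse v u e = EqOn⇒SameElt (reverse v) (reverse u) λ i 1≤i i≤n →
    let y = val (reverse u) i in begin
    eval (reverse v) (+ i)          ≡⟨ cong (eval (reverse v)) (trans (sym (eval-reverse-inverseʳ u (+ i)))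
                                         (sym (eval-cong v u (SameElt⇒EqOn v u e) (eval-range 2≤n (reverse u) (1≤i , i≤n))))) ⟩
    eval (reverse v) (eval v y)     ≡⟨ eval-reverse-inverseˡ v y ⟩
    y                               ∎
    where open ≡-Reasoning

  SameElt-snoc : (r u : List (Fin n)) (t : Fin n) → SameElt n r (u ∷ʳ t) → SameElt n (r ∷ʳ t) u
  SameElt-snoc r u t e = EqOn⇒SameElt (r ∷ʳ t) u λ i 1≤i i≤n → begin
    eval (r ∷ʳ t) (+ i)                        ≡⟨ eval-++ r (t ∷ []) (+ i) ⟩
    eval r (act (num t) (+ i))
      ≡⟨ eval-cong r (u ∷ʳ t) (SameElt⇒EqOn r (u ∷ʳ t) e) (act-range (num t) 2≤n (num≤ t) (1≤i , i≤n)) ⟩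
    eval (u ∷ʳ t) (act (num t) (+ i))          ≡⟨ eval-++ u (t ∷ []) _ ⟩
    eval u (act (num t) (act (num t) (+ i)))   ≡⟨ cong (eval u) (act-involutive (num t) (+ i)) ⟩
    eval u (+ i)                               ∎
    where open ≡-Reasoning

  noDescent⇒identity : (u : List (Fin n)) → (∀ s → ¬ Descent (val u) (num s)) → EqOn (val u) +_ n
  noDescent⇒identity u noDescent = pointwise
    where
    g = val u
    ascent : ∀ k (k<n : suc k ≤ n) → Ascent g (suc k)
    ascent k k<n = ¬Descent⇒Ascent u k λ d →
      noDescent (generator k k<n) (subst (Descent g) (sym (num-generator k k<n)) d)
    increasing : ∀ i → 1 ≤ i → i < n → g i <ℤ g (suc i)
    increasing (suc q) _ i<n = ascent (suc q) i<n
    ∣g1∣<g2 : + ∣ g 1 ∣ <ℤ g 2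
    ∣g1∣<g2 = ∣∣<-intro (increasing 1 (s≤s z≤n) 2≤n) (0<x+y⇒-x<y (g 1) (g 2) (ascent 0 (ℕ.<⇒≤ 2≤n)))
    g-range : ∀ j → 1 ≤ j → j ≤ n → InRange n (g j)
    g-range j 1≤j j≤n = eval-range 2≤n u (1≤j , j≤n)
    g≡id : ∀ {j} → 2 ≤ j → j ≤ n → g j ≡ + j
    g≡id = increasing-squeeze g (λ i 2≤i → increasing i (ℕ.<⇒≤ 2≤i))
             (ℤ.i<j⇒suc[i]≤j (ℤ.≤-<-trans (ℤ.+≤+ (proj₁ (g-range 1 (s≤s z≤n) (ℕ.<⇒≤ 2≤n)))) ∣g1∣<g2))
             (ℤ.≤-trans (i≤+∣i∣ (g n)) (ℤ.+≤+ (proj₂ (g-range n (ℕ.≤-trans (s≤s z≤n) 2≤n) ℕ.≤-refl))))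
    ∣g1∣≡1 : ∣ g 1 ∣ ≡ 1
    ∣g1∣≡1 = ℕ.≤-antisym (ℕ.≤-pred (ℤ.drop‿+<+ (subst (+ ∣ g 1 ∣ <ℤ_) (g≡id ℕ.≤-refl 2≤n) ∣g1∣<g2)))
                         (proj₁ (g-range 1 (s≤s z≤n) (ℕ.<⇒≤ 2≤n)))
    g1≮0 : ¬ (g 1 <ℤ 0ℤ)
    g1≮0 = nonnegativeTail⇒val1≮0 u λ j 2≤j j≤n → subst (0ℤ ≤ℤ_) (sym (g≡id 2≤j j≤n)) (ℤ.+≤+ z≤n)
    g1≡1 : g 1 ≡ + 1
    g1≡1 = trans (sym (ℤ.0≤i⇒+∣i∣≡i (ℤ.≮⇒≥ g1≮0))) (cong +_ ∣g1∣≡1)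
    pointwise : EqOn g +_ n
    pointwise (suc zero) _ _ = g1≡1
    pointwise (suc (suc j)) _ j+2≤n = g≡id (s≤s (s≤s z≤n)) j+2≤n

  inversions≡0⇒identity : (u : List (Fin n)) → inversions (val u) n ≡ 0 → EqOn (val u) +_ n
  inversions≡0⇒identity u u≡0 = noDescent⇒identity u λ s d → ℕ.1+n≢0 (trans (inversions-snoc-descent u s d) u≡0)

  expressionOfLength : ∀ k (u : List (Fin n)) → inversions (val u) n ≡ k →
                       ∃[ r ] SameElt n r u × length r ≡ k
  expressionOfLength zero u u≡0 =
    [] , EqOn⇒SameElt [] u (λ i 1≤i i≤n → sym (inversions≡0⇒identity u u≡0 i 1≤i i≤n)) , refl
  expressionOfLength (suc k) u u≡1+k with Fin.any? (λ s → descent? (val u) (num s))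
  ... | yes (s , d) =
    let r , r≈us , ∣r∣≡k = expressionOfLength k (u ∷ʳ s) (ℕ.suc-injective (trans (inversions-snoc-descent u s d) u≡1+k))
    in r ∷ʳ s , SameElt-snoc r u s r≈us , trans (length-++ r) (trans (ℕ.+-comm (length r) 1) (cong suc ∣r∣≡k))
  ... | no ¬d = ⊥-elim (ℕ.1+n≢0 (begin
    suc k               ≡⟨ u≡1+k ⟨
    inversions (val u) n ≡⟨ inversions-cong n (noDescent⇒identity u λ s d → ¬d (s , d)) ⟩
    inversions +_ n      ≡⟨ inversions-id n ⟩
    0                    ∎))
    where open ≡-Reasoning

  length≡inversions⇒Reduced : (v : List (Fin n)) → length v ≡ inversions (val v) n → Reduced n v
  length≡inversions⇒Reduced v ∣v∣≡inv v′ v′≈v = begin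
    length v               ≡⟨ ∣v∣≡inv ⟩
    inversions (val v) n   ≡⟨ inversions-cong n (λ i 1≤i i≤n → sym (SameElt⇒EqOn v′ v v′≈v i 1≤i i≤n)) ⟩
    inversions (val v′) n  ≤⟨ inversions≤length v′ ⟩
    length v′              ∎
    where open ℕ.≤-Reasoning

  Reduced-reverse : (v : List (Fin n)) → Reduced n v → Reduced n (reverse v)
  Reduced-reverse v red w w≈v′ = begin
    length (reverse v)  ≡⟨ length-reverse v ⟩
    length v
      ≤⟨ red (reverse w) (subst (SameElt n (reverse w)) (reverse-involutive v) (SameElt-reverse w (reverse v) w≈v′)) ⟩
    length (reverse w)  ≡⟨ length-reverse w ⟩
    length w            ∎
    where open ℕ.≤-Reasoning

  NoNoncommutingEnd : List (Fin n) → Set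
  NoNoncommutingEnd u = ∀ v → SameElt n v u → Reduced n v → ¬ EndsNC v

  -- If r is a shortest expression of u t s, then r s t is a reduced expression of u: its length
  -- is the inversion count of u.
  noNoncommutingEnd⇒chain : (u : List (Fin n)) → NoNoncommutingEnd u → NoNoncommutingChain n (val u)
  noNoncommutingEnd⇒chain u noEnd {k} {k′} k<n k′<n nc d d′ =
    endsNC-of (expressionOfLength _ ((u ∷ʳ t) ∷ʳ s) refl)
    where
    t = generator k k<n
    s = generator k′ k′<n
    nc′ : NonCommGen s t
    nc′ = subst₂ NonComm (sym (num-generator k′ k′<n)) (sym (num-generator k k<n)) nc
    dt : Descent (val u) (num t)
    dt = subst (Descent (val u)) (sym (num-generator k k<n)) d
    ds : Descent (val (u ∷ʳ t)) (num s)
    ds = Descent-cong (num s) (val-snoc u t)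
           (subst₂ (λ a b → Descent (rightAct a (val u)) b) (sym (num-generator k k<n)) (sym (num-generator k′ k′<n)) d′)
    endsNC-of : ∃[ r ] SameElt n r ((u ∷ʳ t) ∷ʳ s) × length r ≡ inversions (val ((u ∷ʳ t) ∷ʳ s)) n → ⊥
    endsNC-of (r , r≈uts , ∣r∣≡inv) = noEnd v v≈u (length≡inversions⇒Reduced v ∣v∣≡inv) (r , s , t , refl , nc′)
      where
      v = r ++ s ∷ t ∷ []
      v≈u : SameElt n v u
      v≈u = subst (λ w → SameElt n w u) (++-assoc r (s ∷ []) (t ∷ []))
              (SameElt-snoc (r ∷ʳ s) u t (SameElt-snoc r (u ∷ʳ t) s r≈uts))
      ∣v∣≡inv : length v ≡ inversions (val v) n
      ∣v∣≡inv = begin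
        length v                                        ≡⟨ trans (length-++ r) (ℕ.+-comm (length r) 2) ⟩
        suc (suc (length r))                            ≡⟨ cong (suc ∘ suc) ∣r∣≡inv ⟩
        suc (suc (inversions (val ((u ∷ʳ t) ∷ʳ s)) n))  ≡⟨ cong suc (inversions-snoc-descent (u ∷ʳ t) s ds) ⟩
        suc (inversions (val (u ∷ʳ t)) n)               ≡⟨ inversions-snoc-descent u t dt ⟩
        inversions (val u) n
          ≡⟨ inversions-cong n (λ i 1≤i i≤n → sym (SameElt⇒EqOn v u v≈u i 1≤i i≤n)) ⟩
        inversions (val v) n                            ∎
        where open ≡-Reasoning

  NoNoncommutingStart : List (Fin n) → Set
  NoNoncommutingStart u = ∀ v → SameElt n v u → Reduced n v → ¬ BeginsNC v

  noNoncommutingStart⇒reverse : (u : List (Fin n)) → NoNoncommutingStart u → NoNoncommutingEnd (reverse u)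
  noNoncommutingStart⇒reverse u noStart v v≈u′ red (r , s , t , refl , nc) =
    noStart (reverse v) v′≈u (Reduced-reverse v red) (t , s , reverse r , reverse-++ r (s ∷ t ∷ []) , NonComm-sym nc)
    where
    v′≈u : SameElt n (reverse v) u
    v′≈u = subst (SameElt n (reverse v)) (reverse-involutive u) (SameElt-reverse v (reverse u) v≈u′)

DescentRecovers : ℕ → Window → Set
DescentRecovers m a = ∀ {p} → 1 ≤ p → suc (suc p) ≤ m → a (suc p) <ℤ a p → a p ≤ℤ a (suc (suc p))

module _ {m g} (chain : NoNoncommutingChain m g) where

  chain₁₃ : 3 ≤ m → Descent g 1 → - g 1 ≤ℤ g 3
  chain₁₃ 3≤m d = ℤ.≮⇒≥ (chain (ℕ.<-trans (s≤s z≤n) 3≤m) 3≤m nc31 d)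

  chain₃₁ : 3 ≤ m → Descent g 3 → 0ℤ ≤ℤ g 1 + g 3
  chain₃₁ 3≤m d = ℤ.≮⇒≥ (chain 3≤m (ℕ.<-trans (s≤s z≤n) 3≤m) nc13 d)

  chain₃₂ : 3 ≤ m → Descent g 3 → g 1 ≤ℤ g 3
  chain₃₂ 3≤m d = ℤ.≮⇒≥ (chain 3≤m (ℕ.<-trans (s≤s (s≤s z≤n)) 3≤m) nc23 d)

  chain-pred : ∀ q → 4 ℕ.+ q ≤ m → Descent g (4 ℕ.+ q) → g (2 ℕ.+ q) ≤ℤ g (4 ℕ.+ q)
  chain-pred q k≤m d = ℤ.≮⇒≥ λ lt → chain k≤m (ℕ.<⇒≤ k≤m) (ncUp (3 ℕ.+ q) (s≤s (s≤s (s≤s z≤n)))) d (descent′ lt)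
    where
    descent′ : g (4 ℕ.+ q) <ℤ g (2 ℕ.+ q) → Descent (rightAct (4 ℕ.+ q) g) (3 ℕ.+ q)
    descent′ lt rewrite swapSuc-left (3 ℕ.+ q) | swapSuc-< {3 ℕ.+ q} {2 ℕ.+ q} ℕ.≤-refl = lt

  chain-suc : DescentRecovers m g
  chain-suc {suc zero} _ 3≤m d = ℤ.≮⇒≥ (chain (ℕ.<-trans (s≤s (s≤s z≤n)) 3≤m) 3≤m nc32 d)
  chain-suc {suc (suc p)} _ k≤m d = ℤ.≮⇒≥ λ lt →
    chain (ℕ.<-trans (ℕ.n<1+n _) k≤m) k≤m (ncDown (3 ℕ.+ p) (s≤s (s≤s (s≤s z≤n)))) d (descent′ lt)
    where
    descent′ : g (4 ℕ.+ p) <ℤ g (2 ℕ.+ p) → Descent (rightAct (3 ℕ.+ p) g) (4 ℕ.+ p)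
    descent′ lt rewrite swapSuc-right (2 ℕ.+ p) | swapSuc-> {2 ℕ.+ p} {4 ℕ.+ p} ℕ.≤-refl = lt

-- Windows with a negative entry

module Negative (n : ℕ) (3≤n : 3 ≤ n) (u : List (Fin n)) (chain : NoNoncommutingChain n (val u)) where

  private
    g = val u
    2≤n : 2 ≤ n
    2≤n = ℕ.<⇒≤ 3≤n

  minimum-strict : ∀ {lo p} → MinimumOn g lo n p → ∀ {j} → lo ≤ j → j ≤ n → j ≢ p → g p <ℤ g j
  minimum-strict (_ , _ , min) lo≤j j≤n j≢p = ℤ.≤∧≢⇒< (min _ lo≤j j≤n) (j≢p ∘ sym ∘ val-injective u)

  minimum≤3 : ∀ {lo p} → MinimumOn g lo n p → lo ≤ 2 → p ≤ 3
  minimum≤3 {p = zero} _ _ = z≤n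
  minimum≤3 {p = suc zero} _ _ = s≤s z≤n
  minimum≤3 {p = suc (suc zero)} _ _ = s≤s (s≤s z≤n)
  minimum≤3 {p = suc (suc (suc zero))} _ _ = ℕ.≤-refl
  minimum≤3 {lo} {p = suc (suc (suc (suc q)))} min@(lo≤p , p≤n , _) lo≤2 =
    ⊥-elim (2+q≢4+q (val-injective u
      (ℤ.≤-antisym g[2+q]≤g[4+q] (proj₂ (proj₂ min) (2 ℕ.+ q) lo≤2+q (ℕ.≤-trans (ℕ.m≤n+m _ 2) p≤n)))))
    where
    2+q≢4+q : 2 ℕ.+ q ≢ 4 ℕ.+ q
    2+q≢4+q ()
    lo≤2+q : lo ≤ 2 ℕ.+ q
    lo≤2+q = ℕ.≤-trans lo≤2 (ℕ.m≤m+n 2 q)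
    g[2+q]≤g[4+q] : g (2 ℕ.+ q) ≤ℤ g (4 ℕ.+ q)
    g[2+q]≤g[4+q] = chain-pred chain q p≤n (minimum-strict min (ℕ.m≤n⇒m≤1+n lo≤2+q) (ℕ.<⇒≤ p≤n) (ℕ.1+n≢n ∘ sym))

  g1<0⇒g2<0 : g 1 <ℤ 0ℤ → g 2 <ℤ 0ℤ
  g1<0⇒g2<0 g1<0 = fromTailMinimum (minimumOn g 2≤n)
    where
    fromNegativeTailMinimum : ∀ q → MinimumOn g 2 n q → g q <ℤ 0ℤ → g 2 <ℤ 0ℤ
    fromNegativeTailMinimum (suc zero) (s≤s () , _) _
    fromNegativeTailMinimum (suc (suc zero)) _ g2<0 = g2<0
    fromNegativeTailMinimum (suc (suc (suc zero))) min g3<0 =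
      ⊥-elim (ℤ.<⇒≱ (ℤ.+-mono-< g1<0 g3<0) (chain₃₁ chain 3≤n (minimum-strict min ℕ.≤-refl 2≤n λ ())))
    fromNegativeTailMinimum (suc (suc (suc (suc _)))) min _ with minimum≤3 min ℕ.≤-refl
    ... | s≤s (s≤s (s≤s ()))
    fromTailMinimum : ∃ (MinimumOn g 2 n) → g 2 <ℤ 0ℤ
    fromTailMinimum (q , min@(2≤q , q≤n , _)) with g q ℤ.<? 0ℤ
    ... | no gq≮0 = ⊥-elim (nonnegativeTail⇒val1≮0 n 2≤n u
                              (λ j 2≤j j≤n → ℤ.≤-trans (ℤ.≮⇒≥ gq≮0) (proj₂ (proj₂ min) j 2≤j j≤n)) g1<0)
    ... | yes gq<0 = fromNegativeTailMinimum q min gq<0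

  ∣g1∣<g3 : g 2 <ℤ 0ℤ → g 1 <ℤ g 3 → + ∣ g 1 ∣ <ℤ g 3
  ∣g1∣<g3 g2<0 g1<g3 = ∣∣<-intro g1<g3 -g1<g3
    where
    -g1<g3 : - g 1 <ℤ g 3
    -g1<g3 with g 1 ℤ.<? 0ℤ
    ... | yes g1<0 = ℤ.≤∧≢⇒< (chain₁₃ chain 3≤n (ℤ.+-mono-< g1<0 g2<0)) (val≢-val u 2 1 ∘ sym)
    ... | no g1≮0 = ℤ.≤-<-trans (ℤ.≤-trans (ℤ.neg-mono-≤ (ℤ.≮⇒≥ g1≮0)) (ℤ.≮⇒≥ g1≮0)) g1<g3

  minimum<0⇒g2<0×∣g1∣<g3 : ∀ {p} → MinimumOn g 1 n p → g p <ℤ 0ℤ → g 2 <ℤ 0ℤ × + ∣ g 1 ∣ <ℤ g 3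
  minimum<0⇒g2<0×∣g1∣<g3 {suc zero} min g1<0 = g2<0 , ∣g1∣<g3 g2<0 (minimum-strict min (s≤s z≤n) 3≤n λ ())
    where
    g2<0 = g1<0⇒g2<0 g1<0
  minimum<0⇒g2<0×∣g1∣<g3 {suc (suc zero)} min g2<0 =
    g2<0 , ∣g1∣<g3 g2<0 (ℤ.≤∧≢⇒< (chain-suc chain (s≤s z≤n) 3≤n g2<g1) ((λ ()) ∘ val-injective u))
    where
    g2<g1 = minimum-strict min ℕ.≤-refl (ℕ.<⇒≤ 2≤n) λ ()
  minimum<0⇒g2<0×∣g1∣<g3 {suc (suc (suc zero))} min _ =
    ⊥-elim (ℤ.<⇒≱ (minimum-strict min ℕ.≤-refl (ℕ.<⇒≤ 2≤n) λ ())
                   (chain₃₂ chain 3≤n (minimum-strict min (s≤s z≤n) 2≤n λ ())))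
  minimum<0⇒g2<0×∣g1∣<g3 {suc (suc (suc (suc _)))} min _ with minimum≤3 min (s≤s z≤n)
  ... | s≤s (s≤s (s≤s ()))

-- Windows without negative entries

InSym : ∀ {n} → ℕ → Fin n → Set
InSym m s = 2 ≤ num s × num s ≤ m

act-fixes : ∀ k {j} → 2 ≤ k → k < j → act k (+ j) ≡ + j
act-fixes (suc zero) (s≤s ()) _
act-fixes (suc (suc q)) _ k<j = trans (act-+ q _) (cong +_ (swapSuc-> k<j))

val-fixes : ∀ {n m} (w : List (Fin n)) → All (InSym m) w → ∀ {j} → m < j → val w j ≡ + j
val-fixes [] _ _ = refl
val-fixes (s ∷ w) ((2≤s , s≤m) ∷ ws) m<j =
  trans (cong (act (num s)) (val-fixes w ws m<j)) (act-fixes (num s) 2≤s (ℕ.≤-<-trans s≤m m<j))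

top-commutes : ∀ m {t} → 2 ≤ t → t ≤ m → ¬ NonComm (suc (suc m)) t
top-commutes .1 (s≤s ()) _ nc31
top-commutes .1 _ (s≤s ()) nc32
top-commutes .0 _ () nc23
top-commutes m _ t≤m (ncUp .(suc (suc m)) _) = ℕ.1+n≰n (ℕ.≤-trans (ℕ.m≤n+m (suc m) 2) t≤m)
top-commutes m _ t≤m (ncDown .(suc m) _) = ℕ.1+n≰n t≤m

MapsInto : ℕ → Window → Set
MapsInto m a = ∀ {j} → 1 ≤ j → j ≤ m → ∃ λ c → 1 ≤ c × c ≤ m × a j ≡ + c

InverseOn : ℕ → Window → Window → Set
InverseOn m a b = ∀ {j c} → 1 ≤ j → j ≤ m → a j ≡ + c → b c ≡ + j

record InversePair (m : ℕ) (a b : Window) : Set where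
  field
    a-maps : MapsInto m a
    b-maps : MapsInto m b
    b∘a : InverseOn m a b
    a∘b : InverseOn m b a

InversePair-sym : ∀ {m a b} → InversePair m a b → InversePair m b a
InversePair-sym ip = record { a-maps = b-maps ; b-maps = a-maps ; b∘a = a∘b ; a∘b = b∘a }
  where open InversePair ip

TopClosed : ℕ → ℕ → Window → Set
TopClosed m m′ f = ∀ {c j} → m < c → c ≤ m′ → f c ≡ + j → m < j

InversePair-restrict : ∀ {m m′ a b} → m ≤ m′ → InversePair m′ a b →
                       TopClosed m m′ a → TopClosed m m′ b → InversePair m a b
InversePair-restrict {m} {m′} {a} {b} m≤m′ ip a-closed b-closed = record
  { a-maps = maps a b a-maps b∘a b-closed
  ; b-maps = maps b a b-maps a∘b a-closed
  ; b∘a = λ 1≤j j≤m → b∘a 1≤j (ℕ.≤-trans j≤m m≤m′)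
  ; a∘b = λ 1≤j j≤m → a∘b 1≤j (ℕ.≤-trans j≤m m≤m′)
  }
  where
  open InversePair ip
  maps : ∀ f f⁻¹ → (MapsInto m′ f) → InverseOn m′ f f⁻¹ → TopClosed m m′ f⁻¹ → MapsInto m f
  maps f f⁻¹ f-maps f⁻¹∘f f⁻¹-closed {j} 1≤j j≤m with f-maps 1≤j (ℕ.≤-trans j≤m m≤m′)
  ... | c , 1≤c , c≤m′ , fj≡c with c ℕ.≤? m
  ...   | yes c≤m = c , 1≤c , c≤m , fj≡c
  ...   | no c≰m = ⊥-elim (ℕ.<⇒≱ (f⁻¹-closed (ℕ.≰⇒> c≰m) c≤m′ (f⁻¹∘f 1≤j (ℕ.≤-trans j≤m m≤m′) fj≡c)) j≤m)

module _ {m a b} (ip : InversePair m a b) where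
  open InversePair ip

  maximum-position : 2 ≤ m → DescentRecovers m a → a (pred m) ≡ + m ⊎ a m ≡ + m
  maximum-position 2≤m@(s≤s (s≤s {n = k} z≤n)) recovers with b-maps (ℕ.<⇒≤ 2≤m) ℕ.≤-refl
  ... | p , 1≤p , p≤m , bm≡p with ≤-suc-suc-cases p≤m
  ...   | inj₂ (inj₁ refl) = inj₁ (a∘b (ℕ.<⇒≤ 2≤m) ℕ.≤-refl bm≡p)
  ...   | inj₂ (inj₂ refl) = inj₂ (a∘b (ℕ.<⇒≤ 2≤m) ℕ.≤-refl bm≡p)
  ...   | inj₁ p≤k = ⊥-elim (p≢2+p (ℤ.+-injective (trans (sym bm≡p) (b∘a (s≤s z≤n) (s≤s (s≤s p≤k)) a[2+p]≡m))))
    where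
    p≢2+p : p ≢ suc (suc p)
    p≢2+p ()
    ap≡m : a p ≡ + m
    ap≡m = a∘b (ℕ.<⇒≤ 2≤m) ℕ.≤-refl bm≡p
    a[1+p]<m : a (suc p) <ℤ + m
    a[1+p]<m with a-maps (s≤s z≤n) (s≤s (ℕ.m≤n⇒m≤1+n p≤k))
    ... | c , _ , c≤m , a[1+p]≡c = subst (_<ℤ + m) (sym a[1+p]≡c) (ℤ.+<+ (ℕ.≤∧≢⇒< c≤m c≢m))
      where
      c≢m : c ≢ m
      c≢m refl = ℕ.1+n≢n (ℤ.+-injective (trans (sym (b∘a (s≤s z≤n) (s≤s (ℕ.m≤n⇒m≤1+n p≤k)) a[1+p]≡c)) bm≡p))
    a[2+p]≡m : a (suc (suc p)) ≡ + m
    a[2+p]≡m with a-maps (s≤s z≤n) (s≤s (s≤s p≤k))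
    ... | c , _ , c≤m , a[2+p]≡c = trans a[2+p]≡c (cong +_ (ℕ.≤-antisym c≤m (ℤ.drop‿+≤+ m≤c)))
      where
      m≤c : + m ≤ℤ + c
      m≤c = subst₂ _≤ℤ_ ap≡m a[2+p]≡c (recovers 1≤p (s≤s (s≤s p≤k)) (subst (a (suc p) <ℤ_) (sym ap≡m) a[1+p]<m))

DescentRecovers-weaken : ∀ {m m′ a} → m′ ≤ m → DescentRecovers m a → DescentRecovers m′ a
DescentRecovers-weaken m′≤m recovers 1≤p p+2≤m′ = recovers 1≤p (ℕ.≤-trans p+2≤m′ m′≤m)

TopClosed-fixed : ∀ {m f} → f (suc m) ≡ + suc m → TopClosed m (suc m) f
TopClosed-fixed {m} f[1+m]≡1+m m<c c≤1+m fc≡j with ℕ.≤-antisym c≤1+m m<c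
... | refl = subst (m <_) (ℤ.+-injective (trans (sym f[1+m]≡1+m) fc≡j)) ℕ.≤-refl

TopClosed-swapped : ∀ {m f} → f (suc m) ≡ + suc (suc m) → f (suc (suc m)) ≡ + suc m → TopClosed m (suc (suc m)) f
TopClosed-swapped {m} f[1+m]≡2+m f[2+m]≡1+m m<c c≤2+m fc≡j with ≤-suc-cases c≤2+m
... | inj₂ refl = subst (m <_) (ℤ.+-injective (trans (sym f[2+m]≡1+m) fc≡j)) ℕ.≤-refl
... | inj₁ c≤1+m with ℕ.≤-antisym c≤1+m m<c
...   | refl = subst (m <_) (ℤ.+-injective (trans (sym f[1+m]≡2+m) fc≡j)) (ℕ.n≤1+n (suc m))

InversePair-fixedTop : ∀ {m a b} → InversePair (suc m) a b → a (suc m) ≡ + suc m → InversePair m a b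
InversePair-fixedTop {a = a} {b} ip a[1+m]≡1+m =
  InversePair-restrict (ℕ.n≤1+n _) ip (TopClosed-fixed {f = a} a[1+m]≡1+m)
    (TopClosed-fixed {f = b} (InversePair.b∘a ip (s≤s z≤n) ℕ.≤-refl a[1+m]≡1+m))

InversePair-swappedTop : ∀ {m a b} → InversePair (suc (suc m)) a b → DescentRecovers (suc (suc m)) b →
  a (suc m) ≡ + suc (suc m) → a (suc (suc m)) ≡ + suc m × InversePair m a b
InversePair-swappedTop {m} {a} {b} ip b-recovers a[1+m]≡2+m =
  a[2+m]≡1+m ,
  InversePair-restrict m≤m+2 ip (TopClosed-swapped {f = a} a[1+m]≡2+m a[2+m]≡1+m)
                                (TopClosed-swapped {f = b} b[1+m]≡2+m b[2+m]≡1+m)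
  where
  open InversePair ip
  m≤m+2 : m ≤ suc (suc m)
  m≤m+2 = ℕ.≤-trans (ℕ.n≤1+n m) (ℕ.n≤1+n (suc m))
  b[2+m]≡1+m : b (suc (suc m)) ≡ + suc m
  b[2+m]≡1+m = b∘a (s≤s z≤n) (ℕ.n≤1+n _) a[1+m]≡2+m
  b[1+m]≡2+m : b (suc m) ≡ + suc (suc m)
  b[1+m]≡2+m = [ id , (λ b[2+m]≡2+m → ⊥-elim (ℕ.1+n≢n (ℤ.+-injective (trans (sym b[2+m]≡2+m) b[2+m]≡1+m)))) ]′
                 (maximum-position (InversePair-sym ip) (s≤s (s≤s z≤n)) b-recovers)
  a[2+m]≡1+m : a (suc (suc m)) ≡ + suc m
  a[2+m]≡1+m = a∘b (s≤s z≤n) (ℕ.n≤1+n _) b[1+m]≡2+m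

CommutingExpression : ℕ → ℕ → Window → Set
CommutingExpression n m a = ∃[ w ] MutuallyCommuting {n} w × All (InSym m) w × EqOn (val w) a m

module _ {n : ℕ} where

  EqOn-extend-fixed : ∀ {m a} (w : List (Fin n)) → All (InSym m) w → EqOn (val w) a m →
                      a (suc m) ≡ + suc m → EqOn (val w) a (suc m)
  EqOn-extend-fixed w ws w≈a a[1+m]≡1+m i 1≤i i≤1+m with ≤-suc-cases i≤1+m
  ... | inj₁ i≤m = w≈a i 1≤i i≤m
  ... | inj₂ refl = trans (val-fixes w ws ℕ.≤-refl) (sym a[1+m]≡1+m)

  EqOn-prepend-swap : ∀ {m a} (s : Fin n) → num s ≡ suc (suc m) → (w : List (Fin n)) → All (InSym m) w →
                      EqOn (val w) a m → MapsInto m a → a (suc m) ≡ + suc (suc m) → a (suc (suc m)) ≡ + suc m →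
                      EqOn (val (s ∷ w)) a (suc (suc m))
  EqOn-prepend-swap {m} {a} s s≡2+m w ws w≈a a-maps a[1+m]≡2+m a[2+m]≡1+m i 1≤i i≤2+m = begin
    act (num s) (val w i)        ≡⟨ cong (λ k → act k (val w i)) s≡2+m ⟩
    act (suc (suc m)) (val w i)  ≡⟨ value (≤-suc-suc-cases i≤2+m) ⟩
    a i                          ∎
    where
    open ≡-Reasoning
    value : i ≤ m ⊎ i ≡ suc m ⊎ i ≡ suc (suc m) → act (suc (suc m)) (val w i) ≡ a i
    value (inj₁ i≤m) with a-maps 1≤i i≤m
    ... | c , _ , c≤m , ai≡c = begin
      act (suc (suc m)) (val w i)  ≡⟨ cong (act (suc (suc m))) (trans (w≈a i 1≤i i≤m) ai≡c) ⟩
      act (suc (suc m)) (+ c)      ≡⟨ act-+ m c ⟩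
      + swapSuc (suc m) c          ≡⟨ cong +_ (swapSuc-< (s≤s c≤m)) ⟩
      + c                          ≡⟨ ai≡c ⟨
      a i                          ∎
    value (inj₂ (inj₁ refl)) = begin
      act (suc (suc m)) (val w (suc m))  ≡⟨ cong (act (suc (suc m))) (val-fixes w ws ℕ.≤-refl) ⟩
      act (suc (suc m)) (+ suc m)        ≡⟨ trans (act-+ m (suc m)) (cong +_ (swapSuc-left (suc m))) ⟩
      + suc (suc m)                      ≡⟨ a[1+m]≡2+m ⟨
      a (suc m)                          ∎
    value (inj₂ (inj₂ refl)) = begin
      act (suc (suc m)) (val w (suc (suc m)))  ≡⟨ cong (act (suc (suc m))) (val-fixes w ws (ℕ.n≤1+n (suc m))) ⟩
      act (suc (suc m)) (+ suc (suc m))        ≡⟨ trans (act-+ m (suc (suc m))) (cong +_ (swapSuc-right (suc m))) ⟩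
      + suc m                                  ≡⟨ a[2+m]≡1+m ⟨
      a (suc (suc m))                          ∎

  InSym-weaken : ∀ {m m′} → m ≤ m′ → (w : List (Fin n)) → All (InSym m) w → All (InSym m′) w
  InSym-weaken m≤m′ w = All.map (λ (2≤s , s≤m) → 2≤s , ℕ.≤-trans s≤m m≤m′)

  CommutingExpression-fixedTop : ∀ {m a} → a (suc m) ≡ + suc m →
                                 CommutingExpression n m a → CommutingExpression n (suc m) a
  CommutingExpression-fixedTop a[1+m]≡1+m (w , w-commuting , ws , w≈a) =
    w , w-commuting , InSym-weaken (ℕ.n≤1+n _) w ws , EqOn-extend-fixed w ws w≈a a[1+m]≡1+m

  CommutingExpression-swappedTop : ∀ {m a} → suc (suc m) ≤ n → MapsInto m a →
    a (suc m) ≡ + suc (suc m) → a (suc (suc m)) ≡ + suc m →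
    CommutingExpression n m a → CommutingExpression n (suc (suc m)) a
  CommutingExpression-swappedTop {m} m+2≤n a-maps a[1+m]≡2+m a[2+m]≡1+m (w , w-commuting , ws , w≈a) =
    s ∷ w , All.map s-commutes ws ∷ w-commuting , (s-range ∷ InSym-weaken m≤m+2 w ws) ,
    EqOn-prepend-swap s s≡2+m w ws w≈a a-maps a[1+m]≡2+m a[2+m]≡1+m
    where
    m≤m+2 : m ≤ suc (suc m)
    m≤m+2 = ℕ.≤-trans (ℕ.n≤1+n m) (ℕ.n≤1+n (suc m))
    s = generator (suc m) m+2≤n
    s≡2+m : num s ≡ suc (suc m)
    s≡2+m = num-generator (suc m) m+2≤n
    s-range : InSym (suc (suc m)) s
    s-range = subst (λ k → 2 ≤ k × k ≤ suc (suc m)) (sym s≡2+m) (s≤s (s≤s z≤n) , ℕ.≤-refl)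
    s-commutes : ∀ {t} → InSym m t → ¬ NonCommGen s t
    s-commutes {t} (2≤t , t≤m) nc = top-commutes m 2≤t t≤m (subst (λ k → NonComm k (num t)) s≡2+m nc)

  commutingExpression : ∀ m {a b} → m ≤ n → InversePair m a b → DescentRecovers m a → DescentRecovers m b →
                        CommutingExpression n m a
  commutingExpression zero _ _ _ _ = [] , [] , [] , λ { (suc _) _ () }
  commutingExpression (suc zero) _ ip _ _ with InversePair.a-maps ip (s≤s z≤n) ℕ.≤-refl
  ... | suc zero , _ , _ , a1≡1 = [] , [] , [] , λ { (suc zero) _ _ → sym a1≡1 ; (suc (suc _)) _ (s≤s ()) }
  ... | suc (suc _) , _ , s≤s () , _
  commutingExpression (suc (suc m)) {a} {b} m+2≤n ip a-recovers b-recovers =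
    [ topSwapped (commutingExpression m) , topFixed (commutingExpression (suc m)) ]′
      (maximum-position ip (s≤s (s≤s z≤n)) a-recovers)
    where
    -- The recursive calls are passed in from the clause above, where the termination checker
    -- sees m and suc m decrease.
    Recursion : ℕ → Set
    Recursion k = k ≤ n → InversePair k a b → DescentRecovers k a → DescentRecovers k b → CommutingExpression n k a
    topFixed : Recursion (suc m) → a (suc (suc m)) ≡ + suc (suc m) → CommutingExpression n (suc (suc m)) a
    topFixed recurse a[2+m]≡2+m = CommutingExpression-fixedTop a[2+m]≡2+m
      (recurse (ℕ.<⇒≤ m+2≤n) (InversePair-fixedTop ip a[2+m]≡2+m)
        (DescentRecovers-weaken (ℕ.n≤1+n _) a-recovers) (DescentRecovers-weaken (ℕ.n≤1+n _) b-recovers))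
    topSwapped : Recursion m → a (suc m) ≡ + suc (suc m) → CommutingExpression n (suc (suc m)) a
    topSwapped recurse a[1+m]≡2+m =
      let a[2+m]≡1+m , restricted = InversePair-swappedTop ip b-recovers a[1+m]≡2+m
          m≤m+2 = ℕ.≤-trans (ℕ.n≤1+n m) (ℕ.n≤1+n (suc m))
      in CommutingExpression-swappedTop m+2≤n (InversePair.a-maps restricted) a[1+m]≡2+m a[2+m]≡1+m
           (recurse (ℕ.≤-trans m≤m+2 m+2≤n) restricted
             (DescentRecovers-weaken m≤m+2 a-recovers) (DescentRecovers-weaken m≤m+2 b-recovers))

module _ (n : ℕ) (2≤n : 2 ≤ n) where

  PositiveOn : List (Fin n) → Set
  PositiveOn u = ∀ j → 1 ≤ j → j ≤ n → 0ℤ <ℤ val u j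

  PositiveOn-reverse : (u : List (Fin n)) → PositiveOn u → PositiveOn (reverse u)
  PositiveOn-reverse u pos (suc j) 1≤j j≤n =
    ℤ.≤∧≢⇒< (nonneg (val (reverse u) (suc j)) (eval-range 2≤n (reverse u) (1≤j , j≤n)) (eval-reverse-inverseʳ u (+ suc j)))
            (val≢0 (reverse u) j ∘ sym)
    where
    nonneg : ∀ x → InRange n x → eval u x ≡ + suc j → 0ℤ ≤ℤ x
    nonneg (+ _) _ _ = ℤ.+≤+ z≤n
    nonneg -[1+ k ] (_ , 1+k≤n) e = ⊥-elim (ℤ.<-asym (pos (suc k) (s≤s z≤n) 1+k≤n) (ℤ.neg-cancel-< (begin-strict
      0ℤ               <⟨ ℤ.+<+ (s≤s z≤n) ⟩
      + suc j          ≡⟨ e ⟨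
      eval u -[1+ k ]  ≡⟨ eval-odd u (+ suc k) ⟩
      - val u (suc k)  ∎)))
      where open ℤ.≤-Reasoning

  PositiveOn⇒MapsInto : (u : List (Fin n)) → PositiveOn u → MapsInto n (val u)
  PositiveOn⇒MapsInto u pos {j} 1≤j j≤n =
    ∣ val u j ∣ , proj₁ range , proj₂ range , sym (ℤ.0≤i⇒+∣i∣≡i (ℤ.<⇒≤ (pos j 1≤j j≤n)))
    where
    range = eval-range 2≤n u (1≤j , j≤n)

  PositiveOn⇒InversePair : (u : List (Fin n)) → PositiveOn u → InversePair n (val u) (val (reverse u))
  PositiveOn⇒InversePair u pos = record
    { a-maps = PositiveOn⇒MapsInto u pos
    ; b-maps = PositiveOn⇒MapsInto (reverse u) (PositiveOn-reverse u pos)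
    ; b∘a = λ {j} _ _ uj≡c → trans (cong (eval (reverse u)) (sym uj≡c)) (eval-reverse-inverseˡ u (+ j))
    ; a∘b = λ {j} _ _ u′j≡c → trans (cong (eval u) (sym u′j≡c)) (eval-reverse-inverseʳ u (+ j))
    }

  positive⇒mutuallyCommuting : (u : List (Fin n)) → PositiveOn u →
    NoNoncommutingEnd n 2≤n u → NoNoncommutingStart n 2≤n u → ∃[ w ] SameElt n w u × MutuallyCommuting w
  positive⇒mutuallyCommuting u pos noEnd noStart =
    let w , w-commuting , _ , w≈u = commutingExpression n ℕ.≤-refl (PositiveOn⇒InversePair u pos)
          (chain-suc (noNoncommutingEnd⇒chain n 2≤n u noEnd))
          (chain-suc (noNoncommutingEnd⇒chain n 2≤n (reverse u) (noNoncommutingStart⇒reverse n 2≤n u noStart)))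
    in w , EqOn⇒SameElt n 2≤n w u w≈u , w-commuting

RelativeOrder : ℕ → ℕ → ℕ → Set
RelativeOrder x y z = (x < y × y < z) ⊎ (x < z × z < y) ⊎ (y < x × x < z)

relativeOrder : ∀ {x y z} → x < z → y ≢ x → y ≢ z → RelativeOrder x y z
relativeOrder {x} {y} {z} x<z y≢x y≢z with ℕ.<-cmp y x
... | tri< y<x _ _ = inj₂ (inj₂ (y<x , x<z))
... | tri≈ _ y≡x _ = ⊥-elim (y≢x y≡x)
... | tri> _ _ x<y with ℕ.<-cmp y z
...   | tri< y<z _ _ = inj₁ (x<y , y<z)
...   | tri≈ _ y≡z _ = ⊥-elim (y≢z y≡z)
...   | tri> _ _ z<y = inj₂ (inj₁ (x<z , z<y))

SignsAndOrder : Window → Set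
SignsAndOrder g =
  ((g 2 <ℤ + 0) × (+ 0 <ℤ g 3)) × RelativeOrder (∣ g 1 ∣) (∣ g 2 ∣) (∣ g 3 ∣) × (+ ∣ g 1 ∣ <ℤ g 3)

∣val∣-injective : ∀ {n} (u : List (Fin n)) {i j} → ∣ val u (suc i) ∣ ≡ ∣ val u j ∣ → suc i ≡ j
∣val∣-injective u {i} {j} e with ℤ.+∣i∣≡i⊎+∣i∣≡-i (val u (suc i)) | ℤ.+∣i∣≡i⊎+∣i∣≡-i (val u j)
... | inj₁ p | inj₁ q = val-injective u (trans (sym p) (trans (cong +_ e) q))
... | inj₂ p | inj₂ q = val-injective u (ℤ.neg-injective (trans (sym p) (trans (cong +_ e) q)))
... | inj₁ p | inj₂ q = ⊥-elim (val≢-val u i j (trans (sym p) (trans (cong +_ e) q)))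
... | inj₂ p | inj₁ q = ⊥-elim (val≢-val u i j (trans (sym (ℤ.neg-involutive _)) (cong -_ (trans (sym p) (trans (cong +_ e) q)))))

signsAndOrder : ∀ {n} (u : List (Fin n)) → val u 2 <ℤ 0ℤ × + ∣ val u 1 ∣ <ℤ val u 3 → SignsAndOrder (val u)
signsAndOrder u (u2<0 , ∣u1∣<u3) =
  (u2<0 , 0<u3) , relativeOrder ∣u1∣<∣u3∣ ((λ ()) ∘ ∣val∣-injective u) ((λ ()) ∘ ∣val∣-injective u) , ∣u1∣<u3
  where
  0<u3 : + 0 <ℤ val u 3
  0<u3 = ℤ.≤-<-trans (ℤ.+≤+ z≤n) ∣u1∣<u3
  ∣u1∣<∣u3∣ : ∣ val u 1 ∣ < ∣ val u 3 ∣
  ∣u1∣<∣u3∣ = ℤ.drop‿+<+ (subst (+ ∣ val u 1 ∣ <ℤ_) (sym (ℤ.0≤i⇒+∣i∣≡i (ℤ.<⇒≤ 0<u3))) ∣u1∣<u3)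

lemma2p22 : (n : ℕ) → 4 ≤ n → (u : List (Fin n)) → Bad n u →
    ((val u 2 <ℤ + 0) × (+ 0 <ℤ val u 3)) ×
    (((∣ val u 1 ∣ < ∣ val u 2 ∣) × (∣ val u 2 ∣ < ∣ val u 3 ∣))
      ⊎ ((∣ val u 1 ∣ < ∣ val u 3 ∣) × (∣ val u 3 ∣ < ∣ val u 2 ∣))
      ⊎ ((∣ val u 2 ∣ < ∣ val u 1 ∣) × (∣ val u 1 ∣ < ∣ val u 3 ∣))) ×
    (+ ∣ val u 1 ∣ <ℤ val u 3)
lemma2p22 n 4≤n u (notCommuting , noReducedNC) = fromMinimum (minimumOn (val u) (ℕ.≤-trans (s≤s z≤n) 4≤n))
  where
  3≤n = ℕ.<⇒≤ 4≤n
  2≤n = ℕ.<⇒≤ 3≤n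
  noEnd : NoNoncommutingEnd n 2≤n u
  noEnd v v≈u red = proj₂ (noReducedNC v v≈u red)
  noStart : NoNoncommutingStart n 2≤n u
  noStart v v≈u red = proj₁ (noReducedNC v v≈u red)
  fromMinimum : ∃ (MinimumOn (val u) 1 n) → SignsAndOrder (val u)
  fromMinimum (p , min) with val u p ℤ.<? 0ℤ
  ... | yes up<0 =
    signsAndOrder u (Negative.minimum<0⇒g2<0×∣g1∣<g3 n 3≤n u (noNoncommutingEnd⇒chain n 2≤n u noEnd) min up<0)
  ... | no up≮0 = ⊥-elim (notCommuting (positive⇒mutuallyCommuting n 2≤n u positive noEnd noStart))
    where
    positive : PositiveOn n 2≤n u
    positive (suc j) 1≤j j≤n =
      ℤ.≤∧≢⇒< (ℤ.≤-trans (ℤ.≮⇒≥ up≮0) (proj₂ (proj₂ min) (suc j) 1≤j j≤n)) (val≢0 u j ∘ sym)
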